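{- Let $3\le r<\Delta(G)$ be an odd integer and set $u:=\frac{r-1}{2}$. Let $G$ be a graph whose edge set is partitioned into $(\le 2)$-regular subgraphs $R_0,\dots,R_{t-1}$, each having exactly $n$ edges, with orderings $\ell_0,\dots,\ell_{t-1}$ respectively, subscripts taken modulo $t$. Let $\epsilon$ be a non-zero element of $[\lceil n/2\rceil]$. If $ms(\ell_i,\ell_{i+u+1})\ge \lceil n/2\rceil-\epsilon$ for all $i\in[t-u-1]$ and $ms_3(\ell_i,\ell_{i+u})\ge \lceil 3n/2\rceil-\epsilon$ for all $i\in[t-u]$, then $ms_r(G)\ge \lfloor \frac{rn+1}{2}\rfloor-\epsilon$. If $ms(\ell_i,\ell_{i+u+1})\ge \lceil n/2\rceil-\epsilon$ and $ms_3(\ell_i,\ell_{i+u})\ge \lceil 3n/2\rceil-\epsilon$ for all $i\in[t]$, then $cms_r(G)\ge \lfloor \frac{rn+1}{2}\rfloor-\epsilon$.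
   Context: All graphs are simple; $\Delta(G)$ is the maximum degree. For an integer $N$, $[N]=\{0,\dots,N-1\}$. A graph is $(\le r)$-regular if every vertex has degree at most $r$. An ordering of a graph $H=(V,E)$ is a bijection $\ell:E\to[|E|]$; edges are consecutive (resp. cyclically consecutive) if their labels are consecutive integers (resp. modulo $|E|$). $ms_r(G)$ (resp. $cms_r(G)$) is the maximum over orderings $\ell$ of $G$ of the largest $s$ such that every $s$ consecutive (resp. cyclically consecutive) edges of $\ell$ form a $(\le r)$-regular subgraph. For edge-disjoint graphs $H,H'$ on the same vertex set with orderings $\ell,\ell'$, consider the list of edges of $H$ in the order given by $\ell$ followed by the edges of $H'$ in the order given by $\ell'$; $ms_r(\ell,\ell')$ is the largest integer $s$ such that every $s$ consecutive entries of this list that include at least one edge of $H$ and at least one edge of $H'$ form a $(\le r)$-regular graph; $ms=ms_1$. -}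

module Defs where

open import Data.Nat using (ℕ; zero; suc; _+_; _*_; _∸_; _≤_; _<_; _⊔_; _≤ᵇ_; _<ᵇ_)
open import Data.Nat.DivMod using (_/_; _mod_)
open import Data.Fin using (Fin; toℕ; splitAt)
open import Data.Fin.Properties using (_≟_)
open import Data.Bool using (Bool; true; false; _∧_; _∨_)
open import Data.Product using (_×_; _,_; proj₁; proj₂; Σ; ∃; ∃-syntax; uncurry)
open import Data.Sum using (_⊎_; [_,_]′)
open import Data.List using (List; length; filter; map; foldr; allFin)
open import Data.Nat.ListAction using (sum)
open import Function using (_∘_; const)
open import Function.Bundles using (_↔_; Inverse)
open import Relation.Nullary using (¬_)
open import Relation.Nullary.Decidable using (⌊_⌋)
open import Relation.Binary.PropositionalEquality using (_≡_; _≢_)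
open import Data.Bool using (T)

Edge : ℕ → Set
Edge V = Fin V × Fin V

SameEdge : ∀ {V} → Edge V → Edge V → Set
SameEdge (a , b) (c , d) = ((a ≡ c) × (b ≡ d)) ⊎ ((a ≡ d) × (b ≡ c))

incident : ∀ {V} → Fin V → Edge V → Bool
incident v (a , b) = ⌊ v ≟ a ⌋ ∨ ⌊ v ≟ b ⌋

deg : ∀ {V N} → (Fin N → Edge V) → (Fin N → Bool) → Fin V → ℕ
deg e mask v = length (filter (λ p → T? (mask p ∧ incident v (e p))) (allFin _))
  where
  open import Data.Bool.Properties using (T?)

LeRegular : ∀ {V N} → ℕ → (Fin N → Edge V) → (Fin N → Bool) → Set
LeRegular {V} r e mask = (v : Fin V) → deg e mask v ≤ r

window : ∀ {N} → ℕ → ℕ → Fin N → Bool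
window j s p = (j ≤ᵇ toℕ p) ∧ (toℕ p <ᵇ j + s)

-- mask of the s cyclically consecutive positions j, j+1, ..., j+s-1 (mod N),
-- for j < N and s ≤ N
cwindow : ∀ {N} → ℕ → ℕ → Fin N → Bool
cwindow {N} j s p = ((j ≤ᵇ toℕ p) ∧ (toℕ p <ᵇ j + s)) ∨ (toℕ p + N <ᵇ j + s)

AllWindowsOK : ∀ {V N} → ℕ → (Fin N → Edge V) → ℕ → Set
AllWindowsOK {N = N} r e s = (j : ℕ) → j + s ≤ N → LeRegular r e (window j s)

AllCWindowsOK : ∀ {V N} → ℕ → (Fin N → Edge V) → ℕ → Set
AllCWindowsOK {N = N} r e s = (j : ℕ) → j < N → LeRegular r e (cwindow j s)

-- The graph G with edge partition R_0, ..., R_{t-1}, each with n edges,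
-- presented through orderings ℓ_i : E(R i) ≅ [n];
-- E i k is the edge of R_i with label k under ℓ_i.

EdgeFamily : ℕ → ℕ → ℕ → Set
EdgeFamily V t n = Fin t → Fin n → Edge V

-- G is a simple graph and the R_i are pairwise edge-disjoint:
-- no loops, and distinct labels give distinct (unordered) edges
Simple : ∀ {V t n} → EdgeFamily V t n → Set
Simple {V} {t} {n} E =
  ((i : Fin t) (k : Fin n) → proj₁ (E i k) ≢ proj₂ (E i k)) ×
  ((i i' : Fin t) (k k' : Fin n) → SameEdge (E i k) (E i' k') → (i , k) ≡ (i' , k'))

degR : ∀ {V t n} → EdgeFamily V t n → Fin t → Fin V → ℕ
degR E i v = deg (E i) (const true) v

degG : ∀ {V t n} → EdgeFamily V t n → Fin V → ℕ
degG {t = t} E v = sum (map (λ i → degR E i v) (allFin t))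

Δ : ∀ {V t n} → EdgeFamily V t n → ℕ
Δ {V} E = foldr _⊔_ 0 (map (degG E) (allFin V))

-- ms_r(G) ≥ k : some ordering ℓ of E(G) and some s ≥ k (s ≤ |E(G)|) such that
-- every s consecutive edges of ℓ form a (≤ r)-regular subgraph
MsAtLeast : ∀ {V t n} → ℕ → EdgeFamily V t n → ℕ → Set
MsAtLeast {V} {t} {n} r E k =
  Σ ((Fin t × Fin n) ↔ Fin (t * n)) λ ℓ →
    ∃[ s ] (k ≤ s × s ≤ t * n × AllWindowsOK r (uncurry E ∘ Inverse.from ℓ) s)

CmsAtLeast : ∀ {V t n} → ℕ → EdgeFamily V t n → ℕ → Set
CmsAtLeast {V} {t} {n} r E k =
  Σ ((Fin t × Fin n) ↔ Fin (t * n)) λ ℓ →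
    ∃[ s ] (k ≤ s × s ≤ t * n × AllCWindowsOK r (uncurry E ∘ Inverse.from ℓ) s)

concatSeq : ∀ {V n} → (Fin n → Edge V) → (Fin n → Edge V) → Fin (n + n) → Edge V
concatSeq {n = n} e e' = [ e , e' ]′ ∘ splitAt n

-- ms_r(ℓ,ℓ') ≥ k : some s ≥ k (s ≤ 2n) such that every s consecutive entries
-- including at least one edge of H and one of H' form a (≤ r)-regular graph
MsPairAtLeast : ∀ {V n} → ℕ → (Fin n → Edge V) → (Fin n → Edge V) → ℕ → Set
MsPairAtLeast {n = n} r e e' k =
  ∃[ s ] (k ≤ s × s ≤ n + n ×
    ((j : ℕ) → j + s ≤ n + n → j < n → n < j + s →
      LeRegular r (concatSeq e e') (window j s)))

_⊕_ : ∀ {t} → Fin t → ℕ → Fin t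
_⊕_ {suc t} i k = (toℕ i + k) mod (suc t)

⌈_/2⌉ : ℕ → ℕ
⌈ m /2⌉ = (m + 1) / 2

⌊_/2⌋ : ℕ → ℕ
⌊ m /2⌋ = m / 2

Odd : ℕ → Set
Odd r = ∃[ k ] r ≡ 2 * k + 1

module Submission where

open import Defs
open import Data.Nat using (ℕ; _+_; _*_; _∸_; _≤_; _<_)
open import Data.Nat.DivMod using (_/_)
open import Data.Fin using (Fin; toℕ)
open import Data.Product using (_×_)

open import Data.Bool using (Bool; true; false; T; _∧_; _∨_)
open import Data.Bool.Properties using (T?; T-∧; T-∨)
open import Data.Empty using (⊥-elim)
open import Data.Fin using (fromℕ<; combine; _↑ˡ_; _↑ʳ_)
open import Data.Fin.Properties
  using (toℕ<n; toℕ-fromℕ<; fromℕ<-toℕ; toℕ-injective; toℕ-combine; remQuot-combine; *↔×;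
         splitAt-↑ˡ; splitAt-↑ʳ; toℕ-↑ˡ; toℕ-↑ʳ)
open import Data.List using ([]; _∷_; length; filter; tabulate; map; foldr; allFin)
open import Data.List.Properties using (length-tabulate)
open import Data.Nat using (zero; suc; z≤n; s≤s; z<s; s<s; _≤ᵇ_; _<ᵇ_; _<?_; _≤?_; _⊔_; NonZero)
open import Data.Nat.DivMod
  using (_%_; _mod_; m%n<n; m<n⇒m%n≡m; m%n%n≡m%n; %-distribˡ-+; [m+n]%n≡m%n; m≡m%n+[m/n]*n;
         [m*n+o]%[p*n]≡[m*n]%[p*n]+o; m%n*o≡m*o%[n*o]; +-distrib-/-∣ʳ; m*n/n≡m; m/n<m)
open import Data.Nat.Divisibility using (divides-refl)
open import Data.Nat.ListAction using (sum)
open import Data.Nat.Properties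
open import Data.Nat.Tactic.RingSolver using (solve-∀)
open import Data.Product using (_,_; proj₁; proj₂; uncurry)
open import Data.Sum using (_⊎_; inj₁; inj₂; [_,_]′)
open import Function using (_∘_; const; id)
open import Function.Bundles using (_↔_; Inverse; Equivalence)
open import Function.Properties.Inverse using (↔-sym)
open import Relation.Binary.PropositionalEquality
open import Relation.Nullary using (¬_; yes; no)

-- Order E(G) by concatenating ℓ₀, …, ℓ_{t-1} and put h = ⌈n/2⌉ − ε, so that
-- ⌊(rn+1)/2⌋ − ε = u·n + h.  A window of u·n + h consecutive edges starting at
-- offset a of block q consists of the last n − a edges of R_q, then either u − 1
-- full blocks and the first a + h edges of R_{q+u} (if a + h ≤ n), or u full
-- blocks and the first a + h − n edges of R_{q+u+1}.  A full block raises the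
-- degree of a vertex by at most 2, since R_i is (≤ 2)-regular.  The tail of R_q and
-- the head of R_{q+u} fit into a window of length n + h of ℓ_q ℓ_{q+u}, so by
-- ms₃(ℓ_q, ℓ_{q+u}) ≥ n + h they raise it by at most 3; likewise the tail of R_q
-- and the head of R_{q+u+1} fit into a window of length h of ℓ_q ℓ_{q+u+1} and
-- raise it by at most 1.  Either way the degree is at most 2u + 1 = r.  Cyclic
-- windows are handled by the same count, with block indices read modulo t.

-- Counting along Boolean sequences

indicator : Bool → ℕ
indicator true  = 1
indicator false = 0

indicator-mono : ∀ {b c} → (T b → T c) → indicator b ≤ indicator c
indicator-mono {false}         _   = z≤n
indicator-mono {true}  {true}  _   = ≤-refl
indicator-mono {true}  {false} b⇒c = ⊥-elim (b⇒c _)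

indicator-⊎ : ∀ {b c d} → (T b → T c ⊎ T d) → indicator b ≤ indicator c + indicator d
indicator-⊎ {false}                 _ = z≤n
indicator-⊎ {true}  {true}          _ = s≤s z≤n
indicator-⊎ {true}  {false} {true}  _ = ≤-refl
indicator-⊎ {true}  {false} {false} b⇒c⊎d with b⇒c⊎d _
... | inj₁ ()
... | inj₂ ()

count : (ℕ → Bool) → ℕ → ℕ
count f zero    = 0
count f (suc l) = indicator (f 0) + count (f ∘ suc) l

countFrom : (ℕ → Bool) → ℕ → ℕ → ℕ
countFrom f a = count (λ i → f (a + i))

count-++ : ∀ f l₁ l₂ → count f (l₁ + l₂) ≡ count f l₁ + countFrom f l₁ l₂
count-++ f zero     l₂ = refl
count-++ f (suc l₁) l₂ =
  trans (cong (indicator (f 0) +_) (count-++ (f ∘ suc) l₁ l₂)) (sym (+-assoc (indicator (f 0)) _ _))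

count-cong : ∀ {f g} l → (∀ i → i < l → f i ≡ g i) → count f l ≡ count g l
count-cong zero    _   = refl
count-cong (suc l) f≗g =
  cong₂ _+_ (cong indicator (f≗g 0 z<s)) (count-cong l (λ i i<l → f≗g (suc i) (s<s i<l)))

count-mono : ∀ {f g} l → (∀ i → i < l → T (f i) → T (g i)) → count f l ≤ count g l
count-mono zero    _   = z≤n
count-mono (suc l) f⇒g =
  +-mono-≤ (indicator-mono (f⇒g 0 z<s)) (count-mono l (λ i i<l → f⇒g (suc i) (s<s i<l)))

count-⊎ : ∀ {f g h} l → (∀ i → i < l → T (f i) → T (g i) ⊎ T (h i)) →
          count f l ≤ count g l + count h l
count-⊎ zero    _ = z≤n
count-⊎ {f} {g} {h} (suc l) f⇒g⊎h = begin
  indicator (f 0) + count (f ∘ suc) l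
    ≤⟨ +-mono-≤ (indicator-⊎ (f⇒g⊎h 0 z<s)) (count-⊎ l (λ i i<l → f⇒g⊎h (suc i) (s<s i<l))) ⟩
  (indicator (g 0) + indicator (h 0)) + (count (g ∘ suc) l + count (h ∘ suc) l)
    ≡⟨ +-interchange (indicator (g 0)) (indicator (h 0)) _ _ ⟩
  (indicator (g 0) + count (g ∘ suc) l) + (indicator (h 0) + count (h ∘ suc) l) ∎
  where
  open ≤-Reasoning
  +-interchange : ∀ a b c d → (a + b) + (c + d) ≡ (a + c) + (b + d)
  +-interchange = solve-∀

count-none : ∀ {f} l → (∀ i → i < l → ¬ T (f i)) → count f l ≡ 0
count-none l none = n≤0⇒n≡0 (≤-trans (count-mono l none) (≤-reflexive (count-false l)))
  where
  count-false : ∀ l → count (const false) l ≡ 0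
  count-false zero    = refl
  count-false (suc l) = count-false l

count-mono-length : ∀ {f l m} → l ≤ m → count f l ≤ count f m
count-mono-length {f} {l} {m} l≤m = begin
  count f l                           ≤⟨ m≤m+n (count f l) _ ⟩
  count f l + countFrom f l (m ∸ l)   ≡⟨ count-++ f l (m ∸ l) ⟨
  count f (l + (m ∸ l))               ≡⟨ cong (count f) (m+[n∸m]≡n l≤m) ⟩
  count f m                           ∎
  where open ≤-Reasoning

countFrom-++ : ∀ f a l₁ l₂ → countFrom f a (l₁ + l₂) ≡ countFrom f a l₁ + countFrom f (a + l₁) l₂
countFrom-++ f a l₁ l₂ = trans (count-++ _ l₁ l₂)
  (cong (countFrom f a l₁ +_) (count-cong l₂ (λ i _ → cong f (sym (+-assoc a l₁ i)))))

countFrom≤count : ∀ {f a l m} → a + l ≤ m → countFrom f a l ≤ count f m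
countFrom≤count {f} {a} {l} {m} a+l≤m = begin
  countFrom f a l               ≤⟨ m≤n+m _ (count f a) ⟩
  count f a + countFrom f a l   ≡⟨ count-++ f a l ⟨
  count f (a + l)               ≤⟨ count-mono-length a+l≤m ⟩
  count f m                     ∎
  where open ≤-Reasoning

countFrom-blocks : ∀ {d} f n → (∀ q → countFrom f (q * n) n ≤ d) →
                   ∀ q m → countFrom f (q * n) (m * n) ≤ m * d
countFrom-blocks f n block≤d q zero    = z≤n
countFrom-blocks f n block≤d q (suc m) = begin
  countFrom f (q * n) (n + m * n)
    ≡⟨ countFrom-++ f (q * n) n (m * n) ⟩
  countFrom f (q * n) n + countFrom f (q * n + n) (m * n)
    ≡⟨ cong (λ z → countFrom f (q * n) n + countFrom f z (m * n)) (+-comm (q * n) n) ⟩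
  countFrom f (q * n) n + countFrom f (suc q * n) (m * n)
    ≤⟨ +-mono-≤ (block≤d q) (countFrom-blocks f n block≤d (suc q) m) ⟩
  suc m * _ ∎
  where open ≤-Reasoning

countFrom-tail-blocks-head : ∀ {d} f n → (∀ q → countFrom f (q * n) n ≤ d) → ∀ q a m b → a ≤ n →
  countFrom f (q * n + a) (n ∸ a + m * n + b) ≤
  countFrom f (q * n + a) (n ∸ a) + countFrom f (suc (q + m) * n) b + m * d
countFrom-tail-blocks-head {d} f n block≤d q a m b a≤n = begin
  countFrom f P (n ∸ a + m * n + b)
    ≡⟨ countFrom-++ f P (n ∸ a + m * n) b ⟩
  countFrom f P (n ∸ a + m * n) + countFrom f (P + (n ∸ a + m * n)) b
    ≡⟨ cong₂ _+_ (countFrom-++ f P (n ∸ a) (m * n)) (cong (λ z → countFrom f z b) headStart) ⟩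
  tail + countFrom f (P + (n ∸ a)) (m * n) + head
    ≡⟨ cong (λ z → tail + countFrom f z (m * n) + head) tailEnd ⟩
  tail + countFrom f (suc q * n) (m * n) + head
    ≤⟨ +-monoˡ-≤ head (+-monoʳ-≤ tail (countFrom-blocks f n block≤d (suc q) m)) ⟩
  tail + m * d + head
    ≡⟨ +-right-comm tail (m * d) head ⟩
  tail + head + m * d ∎
  where
  open ≤-Reasoning
  P = q * n + a
  tail = countFrom f P (n ∸ a)
  head = countFrom f (suc (q + m) * n) b
  tailEnd : P + (n ∸ a) ≡ suc q * n
  tailEnd = trans (+-assoc (q * n) a (n ∸ a)) (trans (cong (q * n +_) (m+[n∸m]≡n a≤n)) (+-comm (q * n) n))
  headStart : P + (n ∸ a + m * n) ≡ suc (q + m) * n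
  headStart = trans (sym (+-assoc P (n ∸ a) (m * n)))
                    (trans (cong (_+ m * n) tailEnd) (sym (*-distribʳ-+ n (suc q) m)))
  +-right-comm : ∀ x y z → x + y + z ≡ x + z + y
  +-right-comm = solve-∀

tail+head≡ : ∀ {n a h} → a ≤ n → n ≤ a + h → n ∸ a + (a + h ∸ n) ≡ h
tail+head≡ {n} {a} {h} a≤n n≤a+h = +-cancelˡ-≡ a _ _ (begin
  a + (n ∸ a + (a + h ∸ n))   ≡⟨ +-assoc a (n ∸ a) _ ⟨
  a + (n ∸ a) + (a + h ∸ n)   ≡⟨ cong (_+ (a + h ∸ n)) (m+[n∸m]≡n a≤n) ⟩
  n + (a + h ∸ n)             ≡⟨ m+[n∸m]≡n n≤a+h ⟩
  a + h                       ∎)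
  where open ≡-Reasoning

countFrom-window : ∀ {d} f n → (∀ q → countFrom f (q * n) n ≤ d) → ∀ u h q a → a < n →
  (a + h ≤ n → countFrom f (q * n + a) (n ∸ a) + countFrom f (suc (q + u) * n) (a + h) ≤ suc d) →
  (n < a + h → countFrom f (q * n + a) (n ∸ a) + countFrom f (suc (q + suc u) * n) (a + h ∸ n) ≤ 1) →
  countFrom f (q * n + a) (suc u * n + h) ≤ suc u * d + 1
countFrom-window {d} f n block≤d u h q a a<n short long with a + h ≤? n
... | yes a+h≤n = begin
  countFrom f P (suc u * n + h)                   ≡⟨ cong (countFrom f P) length≡ ⟨
  countFrom f P (n ∸ a + u * n + (a + h))         ≤⟨ countFrom-tail-blocks-head f n block≤d q a u (a + h) a≤n ⟩
  countFrom f P (n ∸ a) + countFrom f (suc (q + u) * n) (a + h) + u * d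
                                                  ≤⟨ +-monoˡ-≤ (u * d) (short a+h≤n) ⟩
  suc d + u * d                                   ≡⟨ +-comm 1 (d + u * d) ⟩
  suc u * d + 1                                   ∎
  where
  open ≤-Reasoning
  P = q * n + a
  a≤n = <⇒≤ a<n
  regroup : ∀ x y a h → x + y + (a + h) ≡ x + a + y + h
  regroup = solve-∀
  length≡ : n ∸ a + u * n + (a + h) ≡ suc u * n + h
  length≡ = trans (regroup (n ∸ a) (u * n) a h) (cong (λ z → z + u * n + h) (m∸n+n≡m a≤n))
... | no a+h≰n = begin
  countFrom f P (suc u * n + h)                   ≡⟨ cong (countFrom f P) length≡ ⟨
  countFrom f P (n ∸ a + suc u * n + (a + h ∸ n))
                                                  ≤⟨ countFrom-tail-blocks-head f n block≤d q a (suc u) (a + h ∸ n) a≤n ⟩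
  countFrom f P (n ∸ a) + countFrom f (suc (q + suc u) * n) (a + h ∸ n) + suc u * d
                                                  ≤⟨ +-monoˡ-≤ (suc u * d) (long n<a+h) ⟩
  1 + suc u * d                                   ≡⟨ +-comm 1 (suc u * d) ⟩
  suc u * d + 1                                   ∎
  where
  open ≤-Reasoning
  P = q * n + a
  a≤n = <⇒≤ a<n
  n<a+h = ≰⇒> a+h≰n
  regroup : ∀ x y z → x + y + z ≡ y + (x + z)
  regroup = solve-∀
  length≡ : n ∸ a + suc u * n + (a + h ∸ n) ≡ suc u * n + h
  length≡ = trans (regroup (n ∸ a) (suc u * n) _) (cong (suc u * n +_) (tail+head≡ a≤n (<⇒≤ n<a+h)))

-- Windows of edge sequences

inWindow : ℕ → ℕ → ℕ → Bool
inWindow j s x = (j ≤ᵇ x) ∧ (x <ᵇ j + s)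

inWindow-intro : ∀ {j s x} → j ≤ x → x < j + s → T (inWindow j s x)
inWindow-intro j≤x x<j+s = Equivalence.from T-∧ (≤⇒≤ᵇ j≤x , <⇒<ᵇ x<j+s)

inWindow-elim : ∀ {j s x} → T (inWindow j s x) → j ≤ x × x < j + s
inWindow-elim {j} {s} {x} w with Equivalence.to T-∧ w
... | j≤ᵇx , x<ᵇj+s = ≤ᵇ⇒≤ j x j≤ᵇx , <ᵇ⇒< x (j + s) x<ᵇj+s

count-inWindow : ∀ f j s m → count (λ x → inWindow j s x ∧ f x) m ≤ countFrom f j s
count-inWindow f j s m = begin
  count W m                                 ≤⟨ count-mono-length (m≤n+m m (j + s)) ⟩
  count W (j + s + m)                       ≡⟨ count-++ W (j + s) m ⟩
  count W (j + s) + countFrom W (j + s) m   ≡⟨ cong₂ _+_ (count-++ W j s) (count-none m after) ⟩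
  count W j + countFrom W j s + 0           ≡⟨ cong (λ c → c + countFrom W j s + 0) (count-none j before) ⟩
  countFrom W j s + 0                       ≡⟨ +-identityʳ _ ⟩
  countFrom W j s                           ≤⟨ count-mono s (λ i _ → proj₂ ∘ Equivalence.to T-∧) ⟩
  countFrom f j s                           ∎
  where
  open ≤-Reasoning
  W = λ x → inWindow j s x ∧ f x
  before : ∀ x → x < j → ¬ T (W x)
  before x x<j w = <⇒≱ x<j (proj₁ (inWindow-elim {j} {s} (proj₁ (Equivalence.to T-∧ w))))
  after : ∀ i → i < m → ¬ T (W (j + s + i))
  after i _ w = <⇒≱ (proj₂ (inWindow-elim {j} {s} (proj₁ (Equivalence.to T-∧ w)))) (m≤m+n (j + s) i)

count-filter-tabulate : ∀ {A : Set} {N} (g : A → Bool) (h : Fin N → A) {f : ℕ → Bool} →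
  (∀ i → f (toℕ i) ≡ g (h i)) → length (filter (T? ∘ g) (tabulate h)) ≡ count f N
count-filter-tabulate {N = zero}  g h f≗ = refl
count-filter-tabulate {N = suc N} g h f≗ rewrite f≗ Fin.zero with g (h Fin.zero)
... | true  = cong suc (count-filter-tabulate g (h ∘ Fin.suc) (f≗ ∘ Fin.suc))
... | false = count-filter-tabulate g (h ∘ Fin.suc) (f≗ ∘ Fin.suc)

deg-count : ∀ {V N} (e : Fin N → Edge V) mask v {f} →
  (∀ p → f (toℕ p) ≡ mask p ∧ incident v (e p)) → deg e mask v ≡ count f N
deg-count e mask v = count-filter-tabulate (λ p → mask p ∧ incident v (e p)) id

module _ {V N} (e : Fin N → Edge V) (v : Fin V) (f : ℕ → Bool)
         (f≗ : ∀ p → f (toℕ p) ≡ incident v (e p)) where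

  deg-window : ∀ j s → deg e (window j s) v ≤ countFrom f j s
  deg-window j s = ≤-trans (≤-reflexive (deg-count e (window j s) v (λ p → cong (window j s p ∧_) (f≗ p))))
                           (count-inWindow f j s N)

  deg-cwindow : (∀ x → f (N + x) ≡ f x) → ∀ {j} s → j < N → deg e (cwindow j s) v ≤ countFrom f j s
  deg-cwindow periodic {j} s j<N = begin
    deg e (cwindow j s) v         ≡⟨ deg-count e (cwindow j s) v (λ p → cong (cwindow j s p ∧_) (f≗ p)) ⟩
    count (λ x → cw x ∧ f x) N    ≤⟨ count-⊎ N unwrap ⟩
    count W N + countFrom W N N   ≡⟨ count-++ W N N ⟨
    count W (N + N)               ≤⟨ count-inWindow f j s (N + N) ⟩
    countFrom f j s               ∎
    where
    open ≤-Reasoning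
    cw = λ x → inWindow j s x ∨ (x + N <ᵇ j + s)
    W = λ x → inWindow j s x ∧ f x
    -- by periodicity, the wrapped-around part of the cyclic window reappears in [N, 2N)
    unwrap : ∀ x → x < N → T (cw x ∧ f x) → T (W x) ⊎ T (W (N + x))
    unwrap x _ w with Equivalence.to T-∧ w
    ... | cwx , fx with Equivalence.to T-∨ cwx
    ...   | inj₁ in-j  = inj₁ (Equivalence.from T-∧ (in-j , fx))
    ...   | inj₂ wraps = inj₂ (Equivalence.from T-∧
            ( inWindow-intro (≤-trans (<⇒≤ j<N) (m≤m+n N x))
                             (subst (_< j + s) (+-comm x N) (<ᵇ⇒< (x + N) (j + s) wraps))
            , subst T (sym (periodic x)) fx))

-- Incidence sequences

incidentAt : ∀ {V N} → (Fin N → Edge V) → Fin V → ℕ → Bool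
incidentAt {N = N} e v x with x <? N
... | yes x<N = incident v (e (fromℕ< x<N))
... | no  _   = false

module _ {V N} (e : Fin N → Edge V) (v : Fin V) where

  incidentAt-< : ∀ {x} (x<N : x < N) → incidentAt e v x ≡ incident v (e (fromℕ< x<N))
  incidentAt-< {x} x<N with x <? N
  ... | yes _   = refl
  ... | no  x≮N = ⊥-elim (x≮N x<N)

  incidentAt-toℕ : ∀ p → incidentAt e v (toℕ p) ≡ incident v (e p)
  incidentAt-toℕ p = trans (incidentAt-< (toℕ<n p)) (cong (incident v ∘ e) (fromℕ<-toℕ p (toℕ<n p)))

  degree-count : deg e (const true) v ≡ count (incidentAt e v) N
  degree-count = deg-count e (const true) v incidentAt-toℕ

module _ {V n} (e e' : Fin n → Edge V) (v : Fin V) where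

  incidentAt-concatˡ : ∀ {x} → x < n → incidentAt (concatSeq e e') v x ≡ incidentAt e v x
  incidentAt-concatˡ x<n = subst (λ y → incidentAt (concatSeq e e') v y ≡ incidentAt e v y)
    (toℕ-fromℕ< x<n) (onFin (fromℕ< x<n))
    where
    onFin : ∀ k → incidentAt (concatSeq e e') v (toℕ k) ≡ incidentAt e v (toℕ k)
    onFin k = begin
      incidentAt (concatSeq e e') v (toℕ k)          ≡⟨ cong (incidentAt (concatSeq e e') v) (toℕ-↑ˡ k n) ⟨
      incidentAt (concatSeq e e') v (toℕ (k ↑ˡ n))   ≡⟨ incidentAt-toℕ (concatSeq e e') v (k ↑ˡ n) ⟩
      incident v (concatSeq e e' (k ↑ˡ n))           ≡⟨ cong (incident v ∘ [ e , e' ]′) (splitAt-↑ˡ n k n) ⟩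
      incident v (e k)                               ≡⟨ incidentAt-toℕ e v k ⟨
      incidentAt e v (toℕ k)                         ∎
      where open ≡-Reasoning

  incidentAt-concatʳ : ∀ {y} → y < n → incidentAt (concatSeq e e') v (n + y) ≡ incidentAt e' v y
  incidentAt-concatʳ y<n = subst (λ y → incidentAt (concatSeq e e') v (n + y) ≡ incidentAt e' v y)
    (toℕ-fromℕ< y<n) (onFin (fromℕ< y<n))
    where
    onFin : ∀ k → incidentAt (concatSeq e e') v (n + toℕ k) ≡ incidentAt e' v (toℕ k)
    onFin k = begin
      incidentAt (concatSeq e e') v (n + toℕ k)      ≡⟨ cong (incidentAt (concatSeq e e') v) (toℕ-↑ʳ n k) ⟨
      incidentAt (concatSeq e e') v (toℕ (n ↑ʳ k))   ≡⟨ incidentAt-toℕ (concatSeq e e') v (n ↑ʳ k) ⟩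
      incident v (concatSeq e e' (n ↑ʳ k))           ≡⟨ cong (incident v ∘ [ e , e' ]′) (splitAt-↑ʳ n n k) ⟩
      incident v (e' k)                              ≡⟨ incidentAt-toℕ e' v k ⟨
      incidentAt e' v (toℕ k)                        ∎
      where open ≡-Reasoning

pair-bound : ∀ {V n R K} {e e' : Fin n → Edge V} (v : Fin V) → MsPairAtLeast R e e' K →
  ∀ {a b} → a < n → 1 ≤ b → b ≤ n → n + b ≤ a + K →
  countFrom (incidentAt e v) a (n ∸ a) + count (incidentAt e' v) b ≤ R
pair-bound {n = n} {R} {K} {e} {e'} v (s , K≤s , s≤2n , windowsOK) {a} {b} a<n 1≤b b≤n n+b≤a+K = begin
  countFrom (incidentAt e v) a (n ∸ a) + count (incidentAt e' v) b
    ≡⟨ cong₂ _+_ (count-cong (n ∸ a) inTail) (count-cong b inHead) ⟨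
  countFrom χ a (n ∸ a) + countFrom χ n b
    ≡⟨ cong (λ z → countFrom χ a (n ∸ a) + countFrom χ z b) (m+[n∸m]≡n a≤n) ⟨
  countFrom χ a (n ∸ a) + countFrom χ (a + (n ∸ a)) b
    ≡⟨ countFrom-++ χ a (n ∸ a) b ⟨
  countFrom χ a (n ∸ a + b)
    ≤⟨ count-mono (n ∸ a + b) insideWindow ⟩
  countFrom W a (n ∸ a + b)
    ≤⟨ countFrom≤count {a = a} (≤-trans (≤-reflexive a+[n∸a+b]≡n+b) (+-monoʳ-≤ n b≤n)) ⟩
  count W (n + n)
    ≡⟨ deg-count (concatSeq e e') (window j s) v (λ p → cong (window j s p ∧_) (incidentAt-toℕ _ v p)) ⟨
  deg (concatSeq e e') (window j s) v
    ≤⟨ windowsOK j j+s≤2n (≤-<-trans j≤a a<n) (<-≤-trans (m<m+n n 1≤b) n+b≤j+s) v ⟩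
  R ∎
  where
  open ≤-Reasoning
  χ = incidentAt (concatSeq e e') v
  a≤n = <⇒≤ a<n
  -- the window ending at n + b, or starting at 0 if s > n + b (truncated subtraction)
  j = n + b ∸ s
  W = λ x → inWindow j s x ∧ χ x
  a+[n∸a+b]≡n+b : a + (n ∸ a + b) ≡ n + b
  a+[n∸a+b]≡n+b = trans (sym (+-assoc a (n ∸ a) b)) (cong (_+ b) (m+[n∸m]≡n a≤n))
  j≤a : j ≤ a
  j≤a = m≤n+o⇒m∸n≤o (n + b) s (≤-trans n+b≤a+K (≤-trans (+-monoʳ-≤ a K≤s) (≤-reflexive (+-comm a s))))
  n+b≤j+s : n + b ≤ j + s
  n+b≤j+s = ≤-trans (m≤n+m∸n (n + b) s) (≤-reflexive (+-comm s j))
  j+s≤2n : j + s ≤ n + n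
  j+s≤2n = m≤o∸n⇒m+n≤o j s≤2n (∸-monoˡ-≤ s (+-monoʳ-≤ n b≤n))
  inTail : ∀ i → i < n ∸ a → χ (a + i) ≡ incidentAt e v (a + i)
  inTail i i<n∸a = incidentAt-concatˡ e e' v (<-≤-trans (+-monoʳ-< a i<n∸a) (≤-reflexive (m+[n∸m]≡n a≤n)))
  inHead : ∀ i → i < b → χ (n + i) ≡ incidentAt e' v i
  inHead i i<b = incidentAt-concatʳ e e' v (<-≤-trans i<b b≤n)
  insideWindow : ∀ i → i < n ∸ a + b → T (χ (a + i)) → T (W (a + i))
  insideWindow i i<l χai = Equivalence.from T-∧
    ( inWindow-intro (≤-trans j≤a (m≤m+n a i))
                     (<-≤-trans (subst (a + i <_) a+[n∸a+b]≡n+b (+-monoʳ-< a i<l)) n+b≤j+s)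
    , χai)

-- The block concatenation of the orderings

mod-+ : ∀ {t} q k → (q + k) mod suc t ≡ (q mod suc t) ⊕ k
mod-+ {t} q k = toℕ-injective (begin
  toℕ ((q + k) mod suc t)                   ≡⟨ toℕ-fromℕ< _ ⟩
  (q + k) % suc t                           ≡⟨ %-distribˡ-+ q k (suc t) ⟩
  (q % suc t + k % suc t) % suc t           ≡⟨ cong (λ z → (z + k % suc t) % suc t) (m%n%n≡m%n q (suc t)) ⟨
  (q % suc t % suc t + k % suc t) % suc t   ≡⟨ %-distribˡ-+ (q % suc t) k (suc t) ⟨
  (q % suc t + k) % suc t                   ≡⟨ cong (λ z → (z + k) % suc t) (toℕ-fromℕ< (m%n<n q (suc t))) ⟨
  (toℕ (q mod suc t) + k) % suc t           ≡⟨ toℕ-fromℕ< _ ⟨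
  toℕ ((q mod suc t) ⊕ k)                   ∎)
  where open ≡-Reasoning

toℕ-mod : ∀ {q t} .{{_ : NonZero t}} → q < t → toℕ (q mod t) ≡ q
toℕ-mod {q} {t} q<t = trans (toℕ-fromℕ< _) (m<n⇒m%n≡m q<t)

module BlockConcatenation {V t′ n′ : ℕ} (E : EdgeFamily V (suc t′) (suc n′)) where

  private
    t n N : ℕ
    t = suc t′
    n = suc n′
    N = t * n

  blockOrdering : (Fin t × Fin n) ↔ Fin N
  blockOrdering = ↔-sym *↔×

  sequence : Fin N → Edge V
  sequence = uncurry E ∘ Inverse.from blockOrdering

  -- Read modulo N, so that cyclic windows of the sequence become ordinary windows of it.
  incidence : Fin V → ℕ → Bool
  incidence v x = incidentAt sequence v (x % N)

  incidence-toℕ : ∀ v p → incidence v (toℕ p) ≡ incident v (sequence p)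
  incidence-toℕ v p =
    trans (cong (incidentAt sequence v) (m<n⇒m%n≡m (toℕ<n p))) (incidentAt-toℕ sequence v p)

  incidence-periodic : ∀ v x → incidence v (N + x) ≡ incidence v x
  incidence-periodic v x =
    cong (incidentAt sequence v) (trans (cong (_% N) (+-comm N x)) ([m+n]%n≡m%n x N))

  incidence-block : ∀ v q {x} → x < n → incidence v (q * n + x) ≡ incidentAt (E (q mod t)) v x
  incidence-block v q {x} x<n = begin
    incidentAt sequence v ((q * n + x) % N)             ≡⟨ cong (incidentAt sequence v) position ⟩
    incidentAt sequence v (toℕ (combine (q mod t) k))   ≡⟨ incidentAt-toℕ sequence v (combine (q mod t) k) ⟩
    incident v (sequence (combine (q mod t) k))         ≡⟨ cong (incident v ∘ uncurry E) (remQuot-combine (q mod t) k) ⟩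
    incident v (E (q mod t) k)                          ≡⟨ incidentAt-< (E (q mod t)) v x<n ⟨
    incidentAt (E (q mod t)) v x                        ∎
    where
    open ≡-Reasoning
    k = fromℕ< x<n
    position : (q * n + x) % N ≡ toℕ (combine (q mod t) k)
    position = begin
      (q * n + x) % (t * n)       ≡⟨ [m*n+o]%[p*n]≡[m*n]%[p*n]+o q t x<n ⟩
      (q * n) % (t * n) + x       ≡⟨ cong (_+ x) (m%n*o≡m*o%[n*o] q t n) ⟨
      q % t * n + x               ≡⟨ cong (_+ x) (*-comm (q % t) n) ⟩
      n * (q % t) + x             ≡⟨ cong₂ (λ z y → n * z + y) (toℕ-fromℕ< (m%n<n q t)) (toℕ-fromℕ< x<n) ⟨
      n * toℕ (q mod t) + toℕ k   ≡⟨ toℕ-combine (q mod t) k ⟨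
      toℕ (combine (q mod t) k)   ∎

  incidence-tail : ∀ v q {a} → a ≤ n →
    countFrom (incidence v) (q * n + a) (n ∸ a) ≡ countFrom (incidentAt (E (q mod t)) v) a (n ∸ a)
  incidence-tail v q {a} a≤n = count-cong (n ∸ a) λ i i<n∸a →
    trans (cong (incidence v) (+-assoc (q * n) a i))
          (incidence-block v q (<-≤-trans (+-monoʳ-< a i<n∸a) (≤-reflexive (m+[n∸m]≡n a≤n))))

  incidence-head : ∀ v q {b} → b ≤ n →
    countFrom (incidence v) (q * n) b ≡ count (incidentAt (E (q mod t)) v) b
  incidence-head v q b≤n = count-cong _ λ i i<b → incidence-block v q (<-≤-trans i<b b≤n)

  incidence-blockDegree : (∀ i v → degR E i v ≤ 2) → ∀ v q → countFrom (incidence v) (q * n) n ≤ 2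
  incidence-blockDegree degR≤2 v q = begin
    countFrom (incidence v) (q * n) n      ≡⟨ incidence-head v q ≤-refl ⟩
    count (incidentAt (E (q mod t)) v) n   ≡⟨ degree-count (E (q mod t)) v ⟨
    degR E (q mod t) v                     ≤⟨ degR≤2 (q mod t) v ⟩
    2                                      ∎
    where open ≤-Reasoning

  -- The u = (r − 1)/2 of the statement is suc u here.
  module Windows (degR≤2 : ∀ i v → degR E i v ≤ 2) (u h K₃ : ℕ)
                 (1≤h : 1 ≤ h) (h<n : h < n) (n+h≤K₃ : n + h ≤ K₃) where

    windowLength : ℕ
    windowLength = suc u * n + h

    windowLength≤ : suc u < t → windowLength ≤ N
    windowLength≤ u<t = begin
      suc u * n + h     ≤⟨ +-monoʳ-≤ (suc u * n) (<⇒≤ h<n) ⟩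
      suc u * n + n     ≡⟨ +-comm (suc u * n) n ⟩
      suc (suc u) * n   ≤⟨ *-monoˡ-≤ n u<t ⟩
      t * n             ∎
      where open ≤-Reasoning

    blockWindow-≤ : ∀ v q a → a < n →
      (a + h ≤ n → MsPairAtLeast 3 (E (q mod t)) (E ((q mod t) ⊕ suc u)) K₃) →
      (n < a + h → MsPairAtLeast 1 (E (q mod t)) (E ((q mod t) ⊕ (suc u + 1))) h) →
      countFrom (incidence v) (q * n + a) windowLength ≤ 2 * suc u + 1
    blockWindow-≤ v q a a<n ms₃ ms₁ = begin
      countFrom (incidence v) (q * n + a) windowLength
        ≤⟨ countFrom-window (incidence v) n (incidence-blockDegree degR≤2 v) u h q a a<n short long ⟩
      suc u * 2 + 1   ≡⟨ cong (_+ 1) (*-comm (suc u) 2) ⟩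
      2 * suc u + 1   ∎
      where
      open ≤-Reasoning
      i = q mod t
      a≤n = <⇒≤ a<n
      χ : Fin t → ℕ → Bool
      χ j = incidentAt (E j) v
      tail = countFrom (incidence v) (q * n + a) (n ∸ a)
      x+[y+z]≡y+[x+z] : ∀ x y z → x + (y + z) ≡ y + (x + z)
      x+[y+z]≡y+[x+z] = solve-∀
      suc[q+U]≡q+[U+1] : ∀ q u → suc (q + suc u) ≡ q + (suc u + 1)
      suc[q+U]≡q+[U+1] = solve-∀

      short : a + h ≤ n → tail + countFrom (incidence v) (suc (q + u) * n) (a + h) ≤ 3
      short a+h≤n = begin
        tail + countFrom (incidence v) (suc (q + u) * n) (a + h)
          ≡⟨ cong₂ _+_ (incidence-tail v q a≤n) (incidence-head v (suc (q + u)) a+h≤n) ⟩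
        countFrom (χ i) a (n ∸ a) + count (χ (suc (q + u) mod t)) (a + h)
          ≡⟨ cong (λ j → countFrom (χ i) a (n ∸ a) + count (χ j) (a + h))
                  (trans (cong (_mod t) (sym (+-suc q u))) (mod-+ q (suc u))) ⟩
        countFrom (χ i) a (n ∸ a) + count (χ (i ⊕ suc u)) (a + h)
          ≤⟨ pair-bound v (ms₃ a+h≤n) a<n (≤-trans 1≤h (m≤n+m h a)) a+h≤n
               (≤-trans (≤-reflexive (x+[y+z]≡y+[x+z] n a h)) (+-monoʳ-≤ a n+h≤K₃)) ⟩
        3 ∎

      long : n < a + h → tail + countFrom (incidence v) (suc (q + suc u) * n) (a + h ∸ n) ≤ 1
      long n<a+h = begin
        tail + countFrom (incidence v) (suc (q + suc u) * n) b
          ≡⟨ cong₂ _+_ (incidence-tail v q a≤n) (incidence-head v (suc (q + suc u)) b≤n) ⟩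
        countFrom (χ i) a (n ∸ a) + count (χ (suc (q + suc u) mod t)) b
          ≡⟨ cong (λ j → countFrom (χ i) a (n ∸ a) + count (χ j) b)
                  (trans (cong (_mod t) (suc[q+U]≡q+[U+1] q u)) (mod-+ q (suc u + 1))) ⟩
        countFrom (χ i) a (n ∸ a) + count (χ (i ⊕ (suc u + 1))) b
          ≤⟨ pair-bound v (ms₁ n<a+h) a<n (m<n⇒0<n∸m n<a+h) b≤n
               (≤-reflexive (m+[n∸m]≡n (<⇒≤ n<a+h))) ⟩
        1 ∎
        where
        b = a + h ∸ n
        b≤n : b ≤ n
        b≤n = m≤n+o⇒m∸n≤o (a + h) n (<⇒≤ (+-mono-< a<n h<n))

    position≡ : ∀ j → j ≡ j / n * n + j % n
    position≡ j = trans (m≡m%n+[m/n]*n j n) (+-comm (j % n) _)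

    windows-≤ : ((i : Fin t) → toℕ i < t ∸ (suc u + 1) → MsPairAtLeast 1 (E i) (E (i ⊕ (suc u + 1))) h) →
                ((i : Fin t) → toℕ i < t ∸ suc u → MsPairAtLeast 3 (E i) (E (i ⊕ suc u)) K₃) →
                AllWindowsOK (2 * suc u + 1) sequence windowLength
    windows-≤ ms₁ ms₃ j j+s≤N v = begin
      deg sequence (window j windowLength) v
        ≤⟨ deg-window sequence v (incidence v) (incidence-toℕ v) j windowLength ⟩
      countFrom (incidence v) j windowLength
        ≡⟨ cong (λ x → countFrom (incidence v) x windowLength) (position≡ j) ⟩
      countFrom (incidence v) (q * n + a) windowLength
        ≤⟨ blockWindow-≤ v q a (m%n<n j n) (ms₃ (q mod t) ∘ lastBlock) (ms₁ (q mod t) ∘ lastBlock′) ⟩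
      2 * suc u + 1 ∎
      where
      open ≤-Reasoning
      q = j / n
      a = j % n
      layout : ∀ q a u n h → q * n + a + (suc u * n + h) ≡ (q + suc u) * n + (a + h)
      layout = solve-∀
      [q+U+1]n≡[q+U]n+n : ∀ q u n → (q + (suc u + 1)) * n ≡ (q + suc u) * n + n
      [q+U+1]n≡[q+U]n+n = solve-∀
      windowEnd≤ : (q + suc u) * n + (a + h) ≤ t * n
      windowEnd≤ = subst (_≤ t * n) (trans (cong (_+ windowLength) (position≡ j)) (layout q a u n h)) j+s≤N
      blockBefore : ∀ k → (q + k) * n < (q + suc u) * n + (a + h) → toℕ (q mod t) < t ∸ k
      blockBefore k before = subst (_< t ∸ k) (sym (toℕ-mod q<t)) (m+n≤o⇒m≤o∸n (suc q) q+k<t)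
        where
        q+k<t = *-cancelʳ-< n (q + k) t (<-≤-trans before windowEnd≤)
        q<t = ≤-<-trans (m≤m+n q k) q+k<t
      lastBlock : a + h ≤ n → toℕ (q mod t) < t ∸ suc u
      lastBlock _ = blockBefore (suc u) (m<m+n _ (≤-trans 1≤h (m≤n+m h a)))
      lastBlock′ : n < a + h → toℕ (q mod t) < t ∸ (suc u + 1)
      lastBlock′ n<a+h = blockBefore (suc u + 1)
        (subst (_< (q + suc u) * n + (a + h)) (sym ([q+U+1]n≡[q+U]n+n q u n)) (+-monoʳ-< _ n<a+h))

    cwindows-≤ : ((i : Fin t) → MsPairAtLeast 1 (E i) (E (i ⊕ (suc u + 1))) h) →
                 ((i : Fin t) → MsPairAtLeast 3 (E i) (E (i ⊕ suc u)) K₃) →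
                 AllCWindowsOK (2 * suc u + 1) sequence windowLength
    cwindows-≤ ms₁ ms₃ j j<N v = begin
      deg sequence (cwindow j windowLength) v
        ≤⟨ deg-cwindow sequence v (incidence v) (incidence-toℕ v) (incidence-periodic v) windowLength j<N ⟩
      countFrom (incidence v) j windowLength
        ≡⟨ cong (λ x → countFrom (incidence v) x windowLength) (position≡ j) ⟩
      countFrom (incidence v) (j / n * n + j % n) windowLength
        ≤⟨ blockWindow-≤ v (j / n) (j % n) (m%n<n j n) (λ _ → ms₃ _) (λ _ → ms₁ _) ⟩
      2 * suc u + 1 ∎
      where open ≤-Reasoning

-- Degree and length arithmetic

foldr-⊔-≤ : ∀ {A : Set} {b} (g : A → ℕ) xs → (∀ x → g x ≤ b) → foldr _⊔_ 0 (map g xs) ≤ b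
foldr-⊔-≤ g []       _   = z≤n
foldr-⊔-≤ g (x ∷ xs) g≤b = ⊔-lub (g≤b x) (foldr-⊔-≤ g xs g≤b)

sum-map-≤ : ∀ {A : Set} {b} (g : A → ℕ) xs → (∀ x → g x ≤ b) → sum (map g xs) ≤ length xs * b
sum-map-≤ g []       _   = z≤n
sum-map-≤ g (x ∷ xs) g≤b = +-mono-≤ (g≤b x) (sum-map-≤ g xs g≤b)

Δ≤ : ∀ {V t n} (E : EdgeFamily V t n) → (∀ i v → degR E i v ≤ 2) → Δ E ≤ t * 2
Δ≤ {V} {t} E degR≤2 = foldr-⊔-≤ (degG E) (allFin V) λ v →
  subst (λ l → degG E v ≤ l * 2) (length-tabulate {n = t} id) (sum-map-≤ _ (allFin t) (λ i → degR≤2 i v))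

⌈m/2⌉≤m : ∀ m → ⌈ m /2⌉ ≤ m
⌈m/2⌉≤m m = m<1+n⇒m≤n (subst (_< suc m) (cong (_/ 2) (+-comm 1 m)) (m/n<m (suc m) 2 (s≤s (s≤s z≤n))))

half-shift : ∀ m k {ε} → ε ≤ ⌈ m /2⌉ → (m + 1 + k * 2) / 2 ∸ ε ≡ k + (⌈ m /2⌉ ∸ ε)
half-shift m k {ε} ε≤ = begin
  (m + 1 + k * 2) / 2 ∸ ε   ≡⟨ cong (_∸ ε) (+-distrib-/-∣ʳ (m + 1) (divides-refl k)) ⟩
  ⌈ m /2⌉ + k * 2 / 2 ∸ ε   ≡⟨ cong (λ z → ⌈ m /2⌉ + z ∸ ε) (m*n/n≡m k 2) ⟩
  ⌈ m /2⌉ + k ∸ ε           ≡⟨ +-∸-comm k ε≤ ⟩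
  ⌈ m /2⌉ ∸ ε + k           ≡⟨ +-comm _ k ⟩
  k + (⌈ m /2⌉ ∸ ε)         ∎
  where open ≡-Reasoning

⌈3n/2⌉∸ε≡ : ∀ n {ε} → ε ≤ ⌈ n /2⌉ → ⌈ 3 * n /2⌉ ∸ ε ≡ n + (⌈ n /2⌉ ∸ ε)
⌈3n/2⌉∸ε≡ n {ε} ε≤ = trans (cong (λ z → z / 2 ∸ ε) (3n+1≡ n)) (half-shift n n ε≤)
  where
  3n+1≡ : ∀ n → 3 * n + 1 ≡ n + 1 + n * 2
  3n+1≡ = solve-∀

⌊rn+1/2⌋∸ε≡ : ∀ u n {ε} → ε ≤ ⌈ n /2⌉ → ⌊ (2 * u + 1) * n + 1 /2⌋ ∸ ε ≡ u * n + (⌈ n /2⌉ ∸ ε)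
⌊rn+1/2⌋∸ε≡ u n {ε} ε≤ = trans (cong (λ z → z / 2 ∸ ε) (rn+1≡ u n)) (half-shift n (u * n) ε≤)
  where
  rn+1≡ : ∀ u n → (2 * u + 1) * n + 1 ≡ n + 1 + u * n * 2
  rn+1≡ = solve-∀

half-pred-odd : ∀ k → (2 * k + 1 ∸ 1) / 2 ≡ k
half-pred-odd k = trans (cong (_/ 2) (trans (m+n∸n≡m (2 * k) 1) (*-comm 2 k))) (m*n/n≡m k 2)

proposition11 : (V t n r ε : ℕ) (E : EdgeFamily V t n) →
    Simple E →
    Odd r → 3 ≤ r → r < Δ E →
    ((i : Fin t) (v : Fin V) → degR E i v ≤ 2) →
    1 ≤ ε → ε < ⌈ n /2⌉ →
    ((((i : Fin t) → toℕ i < t ∸ ((r ∸ 1) / 2 + 1) →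
          MsPairAtLeast 1 (E i) (E (i ⊕ ((r ∸ 1) / 2 + 1))) (⌈ n /2⌉ ∸ ε)) →
      ((i : Fin t) → toℕ i < t ∸ ((r ∸ 1) / 2) →
          MsPairAtLeast 3 (E i) (E (i ⊕ ((r ∸ 1) / 2))) (⌈ 3 * n /2⌉ ∸ ε)) →
      MsAtLeast r E (⌊ r * n + 1 /2⌋ ∸ ε))
    ×
     (((i : Fin t) →
          MsPairAtLeast 1 (E i) (E (i ⊕ ((r ∸ 1) / 2 + 1))) (⌈ n /2⌉ ∸ ε)) →
      ((i : Fin t) →
          MsPairAtLeast 3 (E i) (E (i ⊕ ((r ∸ 1) / 2))) (⌈ 3 * n /2⌉ ∸ ε)) →
      CmsAtLeast r E (⌊ r * n + 1 /2⌋ ∸ ε)))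
proposition11 V t n r ε E _ (zero , refl) (s≤s ()) _ _ _ _
proposition11 V t zero r ε E _ (suc u , refl) _ _ _ _ ()
proposition11 V zero (suc n′) r ε E _ (suc u , refl) _ r<Δ degR≤2 _ _ =
  ⊥-elim (<⇒≱ r<Δ (≤-trans (Δ≤ E degR≤2) z≤n))
proposition11 V (suc t′) (suc n′) r ε E _ (suc u , refl) _ r<Δ degR≤2 1≤ε ε<⌈n/2⌉
  rewrite half-pred-odd (suc u) =
    (λ ms₁ ms₃ → blockOrdering , windowLength , k≤s , windowLength≤ u<t , windows-≤ ms₁ ms₃) ,
    (λ ms₁ ms₃ → blockOrdering , windowLength , k≤s , windowLength≤ u<t , cwindows-≤ ms₁ ms₃)
  where
  n = suc n′
  ε≤ = <⇒≤ ε<⌈n/2⌉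
  open BlockConcatenation E
  open Windows degR≤2 u (⌈ n /2⌉ ∸ ε) (⌈ 3 * n /2⌉ ∸ ε) (m<n⇒0<n∸m ε<⌈n/2⌉)
               (<-≤-trans (∸-monoʳ-< 1≤ε ε≤) (⌈m/2⌉≤m n)) (≤-reflexive (sym (⌈3n/2⌉∸ε≡ n ε≤)))
  k≤s : ⌊ (2 * suc u + 1) * n + 1 /2⌋ ∸ ε ≤ windowLength
  k≤s = ≤-reflexive (⌊rn+1/2⌋∸ε≡ (suc u) n ε≤)
  u<t : suc u < suc t′
  u<t = *-cancelʳ-< 2 (suc u) (suc t′)
    (≤-<-trans (≤-trans (≤-reflexive (*-comm (suc u) 2)) (m≤m+n _ 1)) (<-≤-trans r<Δ (Δ≤ E degR≤2)))
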